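{- Let $M=(I,O,T,t_0,\tau,\mathit{out})$ be a Moore system and let $A=(2^{I\cup O},Q,q_0,\delta,\mathit{acc})$ be a nondeterministic word automaton with transition relation $\delta\subseteq Q\times 2^{I\cup O}\times Q$. Let $D$ be a totally ordered set, $\rho:Q\times T\to D$ a ranking function, and $\triangleright\subseteq Q\times D\times D$ a rank comparison relation (write $d\triangleright_q d'$ for $(q,d,d')\in\triangleright$). Define the formula (with free Boolean-valued function symbol $\mathit{rch}:Q\times T\to\{\mathit{true},\mathit{false}\}$) $$\Phi^{GR}_{\mathsf E}(M,A)=\mathit{rch}(q_0,t_0)\wedge\bigwedge_{(q,t)\in Q\times T}\Big(\mathit{rch}(q,t)\rightarrow\bigvee_{(q,\,i\cup o,\,q')\in\delta}\big(\mathit{out}(t)=o\wedge \mathit{rch}(q',\tau(t,i))\wedge \rho(q,t)\triangleright_q\rho(q',\tau(t,i))\big)\Big),$$ where $i$ ranges over $2^I$ and $o$ over $2^O$. Then $\Phi^{GR}_{\mathsf E}(M,A)$ is satisfiable using $\rho$ and $D$ if and only if the product $M\otimes A_{\mathsf E}$ has an infinite path (starting in $(q_0,t_0)$) that satisfies $\triangleright$ using $\rho$ and $D$.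
   Context: A Moore system $M=(I,O,T,t_0,\tau,\mathit{out})$ has disjoint finite sets of inputs $I$ and outputs $O$, finite states $T$, initial state $t_0$, total transition function $\tau:T\times 2^I\to T$, and output labelling $\mathit{out}:T\to 2^O$. "$\Phi^{GR}_{\mathsf E}(M,A)$ is satisfiable using $\rho$ and $D$" means: with $M$, $\rho$ and $D$ fixed, there is an interpretation of $\mathit{rch}$ making the formula true. The product $M\otimes A_{\mathsf E}$ is the graph with vertex set $Q\times T$, initial vertex $(q_0,t_0)$, and an edge $(q,t)\to(q',\tau(t,i))$ whenever $(q,\,i\cup \mathit{out}(t),\,q')\in\delta$ for some $i\in 2^I$; a path of it starts in $(q_0,t_0)$ and follows edges. An infinite path $\pi=(q_1,t_1)(q_2,t_2)\dots$ satisfies $\triangleright$ using $\rho$ and $D$ iff $\rho(q_j,t_j)\triangleright_{q_j}\rho(q_{j+1},t_{j+1})$ for every $j$. -}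

module Defs where

open import Data.Nat using (ℕ; suc)
open import Data.Fin using (Fin)
open import Data.Fin.Subset using (Subset)
open import Data.Bool using (Bool; true)
open import Data.Product using (Σ; _×_; _,_; proj₁)
open import Relation.Binary.PropositionalEquality using (_≡_)

record Moore (nI nO : ℕ) : Set where
  field
    nT  : ℕ
    t₀  : Fin nT
    τ   : Fin nT → Subset nI → Fin nT
    out : Fin nT → Subset nO

-- Since I and O are disjoint, a letter of 2^(I ∪ O) is a pair i ∪ o with
-- i ∈ 2^I and o ∈ 2^O; we represent it as the pair (i , o).
Letter : ℕ → ℕ → Set
Letter nI nO = Subset nI × Subset nO

-- Nondeterministic word automaton over 2^(I ∪ O) with states Q = Fin nQ,
-- transition relation δ ⊆ Q × 2^(I∪O) × Q and an acceptance component
-- acc of arbitrary type (it plays no role in the statement).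
record Automaton (nI nO : ℕ) : Set₁ where
  field
    nQ  : ℕ
    q₀  : Fin nQ
    δ   : Fin nQ → Letter nI nO → Fin nQ → Set
    Acc : Set
    acc : Acc

module _ {nI nO : ℕ} (M : Moore nI nO) (A : Automaton nI nO) where
  open Moore M
  open Automaton A

  Vertex : Set
  Vertex = Fin nQ × Fin nT

  PhiGR : {D : Set} (ρ : Fin nQ → Fin nT → D) (▷ : Fin nQ → D → D → Set)
          (rch : Fin nQ → Fin nT → Bool) → Set
  PhiGR ρ ▷ rch =
    (rch q₀ t₀ ≡ true) ×
    (∀ q t → rch q t ≡ true →
      Σ (Subset nI) λ i → Σ (Subset nO) λ o → Σ (Fin nQ) λ q' →
        δ q (i , o) q' ×
        (out t ≡ o) × (rch q' (τ t i) ≡ true) × ▷ q (ρ q t) (ρ q' (τ t i)))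

  SatisfiableGR : {D : Set} (ρ : Fin nQ → Fin nT → D) (▷ : Fin nQ → D → D → Set) → Set
  SatisfiableGR ρ ▷ = Σ (Fin nQ → Fin nT → Bool) λ rch → PhiGR ρ ▷ rch

  Edge : Vertex → Vertex → Set
  Edge (q , t) (q' , t') =
    Σ (Subset nI) λ i → δ q (i , out t) q' × (t' ≡ τ t i)

  InfinitePath : (ℕ → Vertex) → Set
  InfinitePath π = (π 0 ≡ (q₀ , t₀)) × (∀ j → Edge (π j) (π (suc j)))

  SatisfiesRank : {D : Set} (ρ : Fin nQ → Fin nT → D) (▷ : Fin nQ → D → D → Set)
                  (π : ℕ → Vertex) → Set
  SatisfiesRank ρ ▷ π = ∀ j → ▷ (proj₁ (π j)) (ρ′ (π j)) (ρ′ (π (suc j)))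
    where ρ′ : Vertex → _
          ρ′ (q , t) = ρ q t

module Submission where

-- Both sides of the equivalence talk about sets of vertices of
-- the product M ⊗ A_E that are closed under "ranked edges": edges
-- (q , t) → (q' , t') along which ρ(q , t) ▷_q ρ(q' , t') holds.
--
-- * Φ^GR_E holds under rch exactly when the set of vertices marked by rch
--   contains (q₀ , t₀) and every marked vertex has a ranked edge to a marked
--   vertex (phi⇒closed, closed⇒phi).
-- * Satisfiable ⇒ path: from a closed set containing the initial vertex one
--   obtains an infinite walk by repeatedly choosing a successor inside the
--   set (walk-from-closed).
-- * Path ⇒ satisfiable: the product is finite, so an infinite walk revisits
--   a vertex, π i ≡ π k with i < k (recurrence).  The vertices visited
--   before time k then form a closed set (prefix-closed), and membership in
--   it is decidable, so it is the set marked by a Boolean rch.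

open import Defs
open import Data.Nat as ℕ using (ℕ; zero; suc; _<_; z≤n)
open import Data.Nat.Properties using (n<1+n; m≤n⇒m<n∨m≡n; ≤-<-trans)
open import Data.Fin using (Fin; toℕ; fromℕ<; combine)
open import Data.Fin.Subset using (Subset)
open import Data.Fin.Properties using (pigeonhole; combine-injective; any?; toℕ-fromℕ<; toℕ<n)
  renaming (_≟_ to _≟ᶠ_)
open import Data.Product using (Σ; _×_; _,_; proj₁; proj₂; ∃₂)
open import Data.Product.Properties using (≡-dec)
open import Data.Sum using (_⊎_; inj₁; inj₂)
open import Data.Bool using (Bool; true)
open import Function.Bundles using (_⇔_; mk⇔)
open import Function.Definitions using (Injective)
open import Relation.Binary.Bundles using (TotalOrder)
open import Relation.Binary.Definitions using (DecidableEquality)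
open import Relation.Binary.PropositionalEquality using (_≡_; refl; sym; trans; cong; subst)
open import Relation.Nullary using (does; proof)
open import Relation.Nullary.Decidable using (dec-true)
open import Relation.Nullary.Reflects using (Reflects; invert)
open import Relation.Unary using (Pred; Decidable)
open import Level using (0ℓ)

module Walks {V : Set} (R : V → V → Set) where

  Walk : (ℕ → V) → Set
  Walk π = ∀ j → R (π j) (π (suc j))

  Closed : Pred V 0ℓ → Set
  Closed P = ∀ v → P v → Σ V λ w → R v w × P w

  walk-from-closed : {P : Pred V 0ℓ} → Closed P →
                     ∀ {v} → P v → Σ (ℕ → V) λ π → π 0 ≡ v × Walk π
  walk-from-closed {P} closed {v} pv = (λ n → proj₁ (seq n)) , refl , edge
    where
    next : Σ V P → Σ V P
    next (w , pw) = let (w' , _ , pw') = closed w pw in w' , pw'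

    seq : ℕ → Σ V P
    seq zero    = v , pv
    seq (suc n) = next (seq n)

    edge : Walk (λ n → proj₁ (seq n))
    edge n = proj₁ (proj₂ (closed (proj₁ (seq n)) (proj₂ (seq n))))

  VisitedBefore : (ℕ → V) → ℕ → Pred V 0ℓ
  VisitedBefore π k v = Σ (Fin k) λ j → π (toℕ j) ≡ v

  visited : (π : ℕ → V) {j k : ℕ} → j < k → VisitedBefore π k (π j)
  visited π j<k = fromℕ< j<k , cong π (toℕ-fromℕ< j<k)

  visitedBefore? : DecidableEquality V → (π : ℕ → V) (k : ℕ) → Decidable (VisitedBefore π k)
  visitedBefore? _≟_ π k v = any? (λ j → π (toℕ j) ≟ v)

  -- Lasso: if a walk returns at time k to the vertex it visited at time
  -- i < k, the vertices visited before k form a closed set, since the walk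
  -- successor of π (k - 1) is π k ≡ π i.
  prefix-closed : {π : ℕ → V} → Walk π → {i k : ℕ} → i < k → π i ≡ π k →
                  Closed (VisitedBefore π k)
  prefix-closed {π} walk {i} {k} i<k return v (j , refl) =
    π (suc (toℕ j)) , walk (toℕ j) , successor-visited (m≤n⇒m<n∨m≡n (toℕ<n j))
    where
    successor-visited : suc (toℕ j) < k ⊎ suc (toℕ j) ≡ k →
                        VisitedBefore π k (π (suc (toℕ j)))
    successor-visited (inj₁ sj<k) = visited π sj<k
    successor-visited (inj₂ sj≡k) =
      subst (VisitedBefore π k) (trans return (cong π (sym sj≡k))) (visited π i<k)

recurrence : {V : Set} {n : ℕ} (encode : V → Fin n) → Injective _≡_ _≡_ encode →
             (s : ℕ → V) → ∃₂ λ i k → i < k × s i ≡ s k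
recurrence {n = n} encode encode-injective s
  with a , b , a<b , same-code ← pigeonhole (n<1+n n) (λ x → encode (s (toℕ x)))
  = toℕ a , toℕ b , a<b , encode-injective same-code

module Product {nI nO : ℕ} (M : Moore nI nO) (A : Automaton nI nO) {D : Set}
  (ρ : Fin (Automaton.nQ A) → Fin (Moore.nT M) → D)
  (▷ : Fin (Automaton.nQ A) → D → D → Set) where
  open Moore M
  open Automaton A

  start : Vertex M A
  start = q₀ , t₀

  rank : Vertex M A → D
  rank (q , t) = ρ q t

  RankedEdge : Vertex M A → Vertex M A → Set
  RankedEdge v w = Edge M A v w × ▷ (proj₁ v) (rank v) (rank w)

  open Walks RankedEdge public

  encode : Vertex M A → Fin (nQ ℕ.* nT)
  encode (q , t) = combine q t

  encode-injective : Injective _≡_ _≡_ encode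
  encode-injective {q , t} {q' , t'} same-code
    with refl , refl ← combine-injective q t q' t' same-code = refl

  _≟ᵛ_ : DecidableEquality (Vertex M A)
  _≟ᵛ_ = ≡-dec _≟ᶠ_ _≟ᶠ_

  path⇒walk : ∀ {π} → InfinitePath M A π × SatisfiesRank M A ρ ▷ π → π 0 ≡ start × Walk π
  path⇒walk ((π0 , edges) , ranked) = π0 , λ j → edges j , ranked j

  walk⇒path : ∀ {π} → π 0 ≡ start × Walk π → InfinitePath M A π × SatisfiesRank M A ρ ▷ π
  walk⇒path (π0 , walk) = (π0 , λ j → proj₁ (walk j)) , λ j → proj₂ (walk j)

  Marked : (Fin nQ → Fin nT → Bool) → Pred (Vertex M A) 0ℓ
  Marked rch (q , t) = rch q t ≡ true

  phi⇒closed : ∀ {rch} → PhiGR M A ρ ▷ rch → Marked rch start × Closed (Marked rch)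
  phi⇒closed {rch} (start-marked , successor) = start-marked , closed
    where
    closed : Closed (Marked rch)
    closed (q , t) marked
      with i , o , q' , transition , refl , marked' , ranked ← successor q t marked
      = (q' , τ t i) , ((i , transition , refl) , ranked) , marked'

  closed⇒phi : {P : Pred (Vertex M A) 0ℓ} (P? : Decidable P) → P start → Closed P →
               PhiGR M A ρ ▷ (λ q t → does (P? (q , t)))
  closed⇒phi {P} P? start-in closed = dec-true (P? start) start-in , successor
    where
    successor : ∀ q t → does (P? (q , t)) ≡ true →
      Σ (Subset nI) λ i → Σ (Subset nO) λ o → Σ (Fin nQ) λ q' →
        δ q (i , o) q' × (out t ≡ o) × (does (P? (q' , τ t i)) ≡ true) ×
        ▷ q (ρ q t) (ρ q' (τ t i))
    successor q t marked
      with (q' , .(τ t i)) , ((i , transition , refl) , ranked) , in-P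
             ← closed (q , t) (invert (subst (Reflects _) marked (proof (P? (q , t)))))
      = i , out t , q' , transition , refl , dec-true (P? _) in-P , ranked

-- The theorem.
mainTheorem1 : {nI nO : ℕ} (M : Moore nI nO) (A : Automaton nI nO)
    (D : TotalOrder 0ℓ 0ℓ 0ℓ)
    (ρ : Fin (Automaton.nQ A) → Fin (Moore.nT M) → TotalOrder.Carrier D)
    (▷ : Fin (Automaton.nQ A) → TotalOrder.Carrier D → TotalOrder.Carrier D → Set) →
    SatisfiableGR M A ρ ▷ ⇔
    Σ (ℕ → Vertex M A) (λ π → InfinitePath M A π × SatisfiesRank M A ρ ▷ π)
mainTheorem1 M A D ρ ▷ = mk⇔ satisfiable⇒path path⇒satisfiable
  where
  open Product M A ρ ▷

  satisfiable⇒path : SatisfiableGR M A ρ ▷ →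
                     Σ (ℕ → Vertex M A) (λ π → InfinitePath M A π × SatisfiesRank M A ρ ▷ π)
  satisfiable⇒path (rch , φ)
    with start-marked , closed ← phi⇒closed φ
    with π , walk ← walk-from-closed closed start-marked
    = π , walk⇒path walk

  path⇒satisfiable : Σ (ℕ → Vertex M A) (λ π → InfinitePath M A π × SatisfiesRank M A ρ ▷ π) →
                     SatisfiableGR M A ρ ▷
  path⇒satisfiable (π , path)
    with π0 , walk ← path⇒walk path
    with i , k , i<k , return ← recurrence encode encode-injective π
    = _ , closed⇒phi (visitedBefore? _≟ᵛ_ π k)
                     (subst (VisitedBefore π k) π0 (visited π (≤-<-trans z≤n i<k)))
                     (prefix-closed walk i<k return)
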